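{- Let $G=(V,A)$ be a permutation DAG and $\gamma$ an umbrella-free topological ordering of its vertices. Then $H(G,\gamma)$ is a DAG.
   Context: A permutation DAG is a directed graph isomorphic to $\mathsf{PermDAG}(\tau)$ for some sequence $\tau$, where $\mathsf{PermDAG}(\tau)$ has vertices $t_1,\ldots,t_n$ and an arc $(t_j,t_i)$ for every $i<j$ with $\tau(i)\le\tau(j)$. A topological ordering of an $n$-vertex DAG $G=(V,A)$ is a bijection $\gamma:V\to[n]$ with $\gamma(u)<\gamma(v)$ for every arc $(v,u)\in A$; it is umbrella-free if for every $(v,u)\in A$ and every $w$ with $\gamma(u)<\gamma(w)<\gamma(v)$, $(w,u)\in A$ or $(v,w)\in A$. Let $\overrightarrow{E}:=\{(u,v):\gamma(u)<\gamma(v)\text{ and }(v,u)\notin A\}$ and $H(G,\gamma):=(V,A\cup\overrightarrow{E})$. -}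

module Defs where

open import Data.Nat using (ℕ; _≤_)
open import Data.Fin using (Fin; _<_)
open import Data.Product using (Σ; _×_)
open import Data.Sum using (_⊎_)
open import Function.Bundles using (_⤖_; Bijection)
open import Relation.Nullary using (¬_)
open import Relation.Binary.Construct.Closure.Transitive using (TransClosure)

-- A directed graph on the vertex set Fin n; G u v means (u , v) is an arc.
Digraph : ℕ → Set₁
Digraph n = Fin n → Fin n → Set

-- PermDAG(τ): vertices t_1..t_n (here Fin n), arc (t_j , t_i) iff i < j and τ(i) ≤ τ(j).
PermDAG : ∀ {n} → (Fin n → ℕ) → Digraph n
PermDAG τ j i = i < j × τ i ≤ τ j

Isomorphic : ∀ {n} → Digraph n → Digraph n → Set
Isomorphic {n} G K =
  Σ (Fin n ⤖ Fin n) λ φ →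
    ∀ u v → (G u v → K (Bijection.to φ u) (Bijection.to φ v))
          × (K (Bijection.to φ u) (Bijection.to φ v) → G u v)

IsPermutationDAG : ∀ {n} → Digraph n → Set
IsPermutationDAG {n} G = Σ (Fin n → ℕ) λ τ → Isomorphic G (PermDAG τ)

-- γ : V → [n] bijection (with [n] rendered as Fin n).
Ordering : ℕ → Set
Ordering n = Fin n ⤖ Fin n

IsTopologicalOrdering : ∀ {n} → Digraph n → Ordering n → Set
IsTopologicalOrdering G γ =
  ∀ v u → G v u → Bijection.to γ u < Bijection.to γ v

UmbrellaFree : ∀ {n} → Digraph n → Ordering n → Set
UmbrellaFree G γ =
  ∀ v u w → G v u → Bijection.to γ u < Bijection.to γ w → Bijection.to γ w < Bijection.to γ v
          → G w u ⊎ G v w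

Erev : ∀ {n} → Digraph n → Ordering n → Digraph n
Erev G γ u v = Bijection.to γ u < Bijection.to γ v × ¬ G v u

H : ∀ {n} → Digraph n → Ordering n → Digraph n
H G γ u v = G u v ⊎ Erev G γ u v

IsDAG : ∀ {n} → Digraph n → Set
IsDAG G = ∀ v → ¬ TransClosure G v v

-- A permutation DAG is transitive, and then so is H(G, γ): two consecutive E→-arcs
-- a → b → c cannot close under an arc (c, a) of G, since b would lie under that umbrella;
-- in the mixed cases the umbrella over the middle vertex, or transitivity of G, gives the
-- arc a → c. Every arc of H points forward in γ, so H is also irreflexive, and a
-- transitive irreflexive relation has no directed cycle.
module Submission where

open import Data.Nat using (ℕ)
import Data.Nat.Properties as ℕₚ
open import Data.Fin using (Fin)
open import Data.Fin.Properties using (<-cmp; <-irrefl; <-trans)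
open import Data.Product using (_,_; proj₁; proj₂)
open import Data.Sum using (inj₁; inj₂; [_,_]′)
open import Function.Bundles using (Bijection)
open import Relation.Binary.Definitions using (Transitive; tri<; tri≈; tri>)
open import Relation.Binary.PropositionalEquality using (refl)
open import Relation.Binary.Construct.Closure.Transitive using (transitive⁻)
open import Relation.Nullary using (¬_)
open import Data.Empty using (⊥-elim)
open import Defs

PermDAG-transitive : ∀ {n} (τ : Fin n → ℕ) → Transitive (PermDAG τ)
PermDAG-transitive τ (i<j , τi≤τj) (k<i , τk≤τi) = <-trans k<i i<j , ℕₚ.≤-trans τk≤τi τi≤τj

Isomorphic-transitive : ∀ {n} {G : Digraph n} (K : Digraph n) →
  Isomorphic G K → Transitive K → Transitive G
Isomorphic-transitive _ (_ , φ) trans {u} {v} {w} uv vw =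
  proj₂ (φ u w) (trans (proj₁ (φ u v) uv) (proj₁ (φ v w) vw))

IsPermutationDAG⇒transitive : ∀ {n} {G : Digraph n} → IsPermutationDAG G → Transitive G
IsPermutationDAG⇒transitive (τ , G≅PermDAG) =
  Isomorphic-transitive (PermDAG τ) G≅PermDAG (PermDAG-transitive τ)

transitive-irreflexive⇒IsDAG : ∀ {n} {R : Digraph n} →
  Transitive R → (∀ v → ¬ R v v) → IsDAG R
transitive-irreflexive⇒IsDAG trans irrefl v cycle = irrefl v (transitive⁻ _ trans cycle)

H-irreflexive : ∀ {n} (G : Digraph n) (γ : Ordering n) →
  IsTopologicalOrdering G γ → ∀ v → ¬ H G γ v v
H-irreflexive _ _ top v (inj₁ vv) = <-irrefl refl (top v v vv)
H-irreflexive _ _ top v (inj₂ (γv<γv , _)) = <-irrefl refl γv<γv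

module _ {n} (G : Digraph n) (γ : Ordering n)
         (G-trans : Transitive G) (umbrella-free : UmbrellaFree G γ) where

  open Bijection γ using (to; injective)

  Erev-transitive : Transitive (Erev G γ)
  Erev-transitive {a} {b} {c} (γa<γb , ¬ba) (γb<γc , ¬cb) =
    <-trans γa<γb γb<γc , λ ca → [ ¬ba , ¬cb ]′ (umbrella-free c a b ca γa<γb γb<γc)

  G-Erev⇒H : ∀ {a b c} → G a b → Erev G γ b c → H G γ a c
  G-Erev⇒H {a} {b} {c} ab (γb<γc , ¬cb) with <-cmp (to a) (to c)
  ... | tri< γa<γc _ _ = inj₂ (γa<γc , λ ca → ¬cb (G-trans ca ab))
  ... | tri≈ _ γa≡γc _ with refl ← injective γa≡γc = ⊥-elim (¬cb ab)
  ... | tri> _ _ γc<γa = [ (λ cb → ⊥-elim (¬cb cb)) , inj₁ ]′ (umbrella-free a b c ab γb<γc γc<γa)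

  Erev-G⇒H : ∀ {a b c} → Erev G γ a b → G b c → H G γ a c
  Erev-G⇒H {a} {b} {c} (γa<γb , ¬ba) bc with <-cmp (to a) (to c)
  ... | tri< γa<γc _ _ = inj₂ (γa<γc , λ ca → ¬ba (G-trans bc ca))
  ... | tri≈ _ γa≡γc _ with refl ← injective γa≡γc = ⊥-elim (¬ba bc)
  ... | tri> _ _ γc<γa = [ inj₁ , (λ ba → ⊥-elim (¬ba ba)) ]′ (umbrella-free b c a bc γc<γa γa<γb)

  H-transitive : Transitive (H G γ)
  H-transitive (inj₁ ab) (inj₁ bc) = inj₁ (G-trans ab bc)
  H-transitive (inj₁ ab) (inj₂ bc) = G-Erev⇒H ab bc
  H-transitive (inj₂ ab) (inj₁ bc) = Erev-G⇒H ab bc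
  H-transitive (inj₂ ab) (inj₂ bc) = inj₂ (Erev-transitive ab bc)

lemma6 : ∀ (n : ℕ) (G : Digraph n) (γ : Ordering n) →
    IsPermutationDAG G → IsTopologicalOrdering G γ → UmbrellaFree G γ →
    IsDAG (H G γ)
lemma6 n G γ permDAG top umbrella-free =
  transitive-irreflexive⇒IsDAG
    (H-transitive G γ (IsPermutationDAG⇒transitive permDAG) umbrella-free)
    (H-irreflexive G γ top)
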